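{- For all $n\ge1$: $\Omega_0^{(n)}=\mathrm{C}_n$, $\Omega_n^{(n)}=1$, and for every $r\in[1,n-1]$, $$\Omega_r^{(n)}=\sum_{i=r-1}^{n-1}\binom{i}{r-1}\left(1+\sum_{j=i+1}^{n-1}\theta_j^{(n)}\right),$$ where an empty inner sum is $0$.
   Context: $\mathrm{C}_m=\frac{1}{m+1}\binom{2m}{m}$ is the $m$-th Catalan number. Indexing matrices (for $n$): either the degenerate matrix $\left[\begin{smallmatrix}\infty\\ \infty\end{smallmatrix}\right]$, or a $2\times m$ matrix $A=[a_{ij}]$ with $1\le m\le n$ such that: $a_{ij}\in[0,n-1]$; $a_{1j}<a_{1k}$ for $j<k$; $a_{2j}\le a_{2k}$ for $j<k$; if $a_{2j}=a_{2k}$ with $j<k$ then $a_{2j}=a_{2k}=0$; $a_{1j}\ge a_{2j}$ for all $j$. The blob-rank of $A$ is the number of its columns containing a $0$ (the degenerate matrix has blob-rank $0$); $\Omega_r^{(n)}$ is the number of indexing matrices for $n$ of blob-rank $r$. A non-degenerate indexing matrix is positive if all its entries are positive; for $n\ge 2$, $k\in[1,n-1]$, $\theta_k^{(n)}$ is the number of positive non-degenerate indexing matrices $C=[c_{ij}]$ for $n$ with $c_{11}=k$. -}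

module Defs where

open import Data.Nat using (ℕ; zero; suc; _+_; _*_; _∸_; _≤_; _<_)
open import Data.Nat.Properties as ℕP using ()
open import Data.Nat.Combinatorics using (_C_)
open import Data.Nat.DivMod using (_/_)
open import Data.Fin using (Fin; toℕ) renaming (_<_ to _<ᶠ_)
open import Data.Fin.Properties as FinP using (all?)
open import Data.Product using (_×_; _,_; proj₁; proj₂)
open import Data.Sum using (_⊎_)
open import Data.Vec using (Vec; []; _∷_; lookup; head)
open import Data.List using (List; []; _∷_; map; concatMap; allFin; filter; length; upTo)
open import Data.Nat.ListAction using (sum)
open import Relation.Binary.PropositionalEquality using (_≡_)
open import Relation.Nullary.Decidable using (Dec; _×-dec_; _⊎-dec_; _→-dec_)

Catalan : ℕ → ℕ
Catalan m = ((2 * m) C m) / suc m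

-- Σ_{i = a}^{b} f i   (empty, i.e. 0, when a > b)
sumFromTo : ℕ → ℕ → (ℕ → ℕ) → ℕ
sumFromTo a b f = sum (map (λ t → f (a + t)) (upTo (suc b ∸ a)))

Column : ℕ → Set
Column n = Fin n × Fin n

-- A (non-degenerate) 2×m matrix with entries in [0,n-1]; column j is (a1 j, a2 j)
Matrix : ℕ → ℕ → Set
Matrix n m = Vec (Column n) m

a1 : ∀ {n m} → Matrix n m → Fin m → ℕ
a1 A j = toℕ (proj₁ (lookup A j))

a2 : ∀ {n m} → Matrix n m → Fin m → ℕ
a2 A j = toℕ (proj₂ (lookup A j))

-- The defining conditions of a non-degenerate indexing matrix (besides 1 ≤ m ≤ n
-- and entries in [0,n-1], which are built into the enumeration / type).
IsIndexing : ∀ {n m} → Matrix n m → Set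
IsIndexing {m = m} A =
  (∀ (j k : Fin m) → j <ᶠ k → a1 A j < a1 A k)
  × (∀ (j k : Fin m) → j <ᶠ k → a2 A j ≤ a2 A k)
  × (∀ (j k : Fin m) → j <ᶠ k → a2 A j ≡ a2 A k → (a2 A j ≡ 0 × a2 A k ≡ 0))
  × (∀ (j : Fin m) → a2 A j ≤ a1 A j)

isIndexing? : ∀ {n m} (A : Matrix n m) → Dec (IsIndexing A)
isIndexing? A =
  all? (λ j → all? (λ k → (j FinP.<? k) →-dec (a1 A j ℕP.<? a1 A k)))
  ×-dec all? (λ j → all? (λ k → (j FinP.<? k) →-dec (a2 A j ℕP.≤? a2 A k)))
  ×-dec all? (λ j → all? (λ k → (j FinP.<? k) →-dec ((a2 A j ℕP.≟ a2 A k)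
           →-dec ((a2 A j ℕP.≟ 0) ×-dec (a2 A k ℕP.≟ 0)))))
  ×-dec all? (λ j → a2 A j ℕP.≤? a1 A j)

ContainsZero : ∀ {n} → Column n → Set
ContainsZero (x , y) = toℕ x ≡ 0 ⊎ toℕ y ≡ 0

containsZero? : ∀ {n} (c : Column n) → Dec (ContainsZero c)
containsZero? (x , y) = (toℕ x ℕP.≟ 0) ⊎-dec (toℕ y ℕP.≟ 0)

blobRank : ∀ {n m} → Matrix n m → ℕ
blobRank {m = m} A = length (filter (λ j → containsZero? (lookup A j)) (allFin m))

allMatrices : (n m : ℕ) → List (Matrix n m)
allMatrices n zero = [] ∷ []
allMatrices n (suc m) =
  concatMap (λ c → map (c ∷_) (allMatrices n m))
    (concatMap (λ x → map (x ,_) (allFin n)) (allFin n))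

countWidth : (r n m : ℕ) → ℕ
countWidth r n m =
  length (filter (λ A → isIndexing? A ×-dec (blobRank A ℕP.≟ r)) (allMatrices n m))

-- contribution of the degenerate matrix [∞;∞] (blob-rank 0)
degenerate : ℕ → ℕ
degenerate zero = 1
degenerate (suc _) = 0

Ω : (r n : ℕ) → ℕ
Ω r n = degenerate r + sumFromTo 1 n (countWidth r n)

Positive : ∀ {n m} → Matrix n m → Set
Positive {m = m} A = ∀ (j : Fin m) → (0 < a1 A j × 0 < a2 A j)

positive? : ∀ {n m} (A : Matrix n m) → Dec (Positive A)
positive? A = all? (λ j → (0 ℕP.<? a1 A j) ×-dec (0 ℕP.<? a2 A j))

c11 : ∀ {n m} → Matrix n (suc m) → ℕ
c11 A = toℕ (proj₁ (head A))

countθ : (k n m : ℕ) → ℕ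
countθ k n m =
  length (filter (λ A → isIndexing? A ×-dec positive? A ×-dec (c11 A ℕP.≟ k))
                 (allMatrices n (suc m)))

θ : (k n : ℕ) → ℕ
θ k n = sumFromTo 0 (n ∸ 1) (countθ k n)

-- An indexing matrix is a chain of columns in which each column only has to be compatible
-- with its predecessor, so the number of matrices whose columns may follow a column with
-- first entry below lo and second entry y obeys a recursion on the first column; summed over
-- widths, the degenerate matrix plays the part of the empty one.
--
-- Blob columns all have second entry 0 and form an initial segment: once a second entry is
-- positive, the second row increases strictly. So a matrix of blob-rank r ≥ 1 consists of r
-- blob columns with first entries in [0, i], the last one equal to i, chosen in C(i, r − 1)
-- ways, followed by a blob-free tail with first entries above i, which is either empty or a
-- positive indexing matrix with c₁₁ = j > i.
--
-- Blob-free chains satisfy the ballot recursion P(lo, y) = P(lo + 1, y) + Σ_{y<b≤lo} P(lo + 1, b),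
-- so Ω₀ = P(1, 0) is the central ballot number C(2n, n) − C(2n, n − 1) = C_n.

module Submission where

open import Defs
open import Data.Bool using (true; false; if_then_else_)
open import Data.Fin using (Fin; toℕ) renaming (zero to fzero; suc to fsuc; _<_ to _<ᶠ_)
open import Data.List using (List; []; _∷_; _++_; map; concatMap; filter; length; applyUpTo; upTo; allFin; tabulate)
open import Data.List.Properties
  using (map-applyUpTo; map-∘; map-cong; map-tabulate; map-++; length-++;
         filter-++; filter-≐; filter-none; filter-accept; filter-reject)
import Data.List.Relation.Unary.All as All
open import Data.Nat using (ℕ; zero; suc; _+_; _*_; _∸_; _≤_; _<_; z≤n; s≤s)
open import Data.Nat.Combinatorics using (_C_; nCk+nC[k+1]≡[n+1]C[k+1]; nCk≡nC[n∸k]; k>n⇒nCk≡0; nCn≡1; nC1≡n)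
open import Data.Nat.DivMod using (_/_; m*n/n≡m)
open import Data.Nat.ListAction using (sum)
open import Data.Nat.ListAction.Properties using (sum-++)
open import Data.Nat.Properties
open import Data.Nat.Tactic.RingSolver using (solve-∀)
open import Algebra.Properties.CommutativeSemigroup +-commutativeSemigroup
  using () renaming (interchange to +-interchange)
open import Data.Product using (_×_; _,_; proj₁; proj₂; map₁)
open import Data.Sum using (_⊎_; inj₁; inj₂)
open import Data.Unit using (⊤; tt)
open import Data.Vec using (_∷_; []; lookup)
open import Function using (_∘_)
open import Function.Bundles using (_⇔_; mk⇔; Equivalence)
open import Level using (0ℓ)
open import Relation.Binary.Definitions using (tri<; tri≈; tri>)
open import Relation.Binary.PropositionalEquality hiding ([_])
open import Relation.Nullary using (Dec; yes; no; does; ¬_; contradiction)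
open import Relation.Nullary.Decidable using (_×-dec_; _⊎-dec_)
open import Relation.Unary using (Pred; Decidable; _≐_)

-- Finite sums and Iverson brackets

∑< : ℕ → (ℕ → ℕ) → ℕ
∑< zero    f = 0
∑< (suc k) f = f 0 + ∑< k (f ∘ suc)

infixl 10 ∑<
syntax ∑< k (λ t → e) = ∑[ t < k ] e

∑-cong : ∀ k {f g : ℕ → ℕ} → (∀ t → t < k → f t ≡ g t) → ∑< k f ≡ ∑< k g
∑-cong zero    eq = refl
∑-cong (suc k) eq = cong₂ _+_ (eq 0 (s≤s z≤n)) (∑-cong k (λ t t<k → eq (suc t) (s≤s t<k)))

∑-≡0 : ∀ k {f : ℕ → ℕ} → (∀ t → t < k → f t ≡ 0) → ∑< k f ≡ 0
∑-≡0 k eq = trans (∑-cong k {g = λ _ → 0} eq) (∑-zero k)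
  where
  ∑-zero : ∀ k → ∑[ t < k ] 0 ≡ 0
  ∑-zero zero    = refl
  ∑-zero (suc k) = ∑-zero k

∑-last : ∀ k (f : ℕ → ℕ) → ∑< (suc k) f ≡ ∑< k f + f k
∑-last zero    f = +-comm (f 0) 0
∑-last (suc k) f = trans (cong (f 0 +_) (∑-last k (f ∘ suc))) (sym (+-assoc (f 0) _ _))

∑-distrib-+ : ∀ k (f g : ℕ → ℕ) → ∑[ t < k ] (f t + g t) ≡ ∑< k f + ∑< k g
∑-distrib-+ zero    f g = refl
∑-distrib-+ (suc k) f g =
  trans (cong (f 0 + g 0 +_) (∑-distrib-+ k (f ∘ suc) (g ∘ suc))) (+-interchange (f 0) (g 0) _ _)

∑-comm : ∀ a b (f : ℕ → ℕ → ℕ) → ∑[ i < a ] ∑[ j < b ] f i j ≡ ∑[ j < b ] ∑[ i < a ] f i j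
∑-comm zero    b f = sym (∑-≡0 b (λ _ _ → refl))
∑-comm (suc a) b f =
  trans (cong (∑< b (f 0) +_) (∑-comm a b (f ∘ suc))) (sym (∑-distrib-+ b (f 0) _))

sum-applyUpTo : ∀ k (f : ℕ → ℕ) → sum (applyUpTo f k) ≡ ∑< k f
sum-applyUpTo zero    f = refl
sum-applyUpTo (suc k) f = cong (f 0 +_) (sum-applyUpTo k (f ∘ suc))

sum-map-upTo : ∀ k (f : ℕ → ℕ) → sum (map f (upTo k)) ≡ ∑< k f
sum-map-upTo k f = trans (cong sum (map-applyUpTo (λ t → t) f k)) (sum-applyUpTo k f)

sumFromTo≡∑ : ∀ a b (f : ℕ → ℕ) → sumFromTo a b f ≡ ∑[ t < suc b ∸ a ] f (a + t)
sumFromTo≡∑ a b f = sum-map-upTo (suc b ∸ a) (f ∘ (a +_))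

sumFromTo-single : ∀ a (f : ℕ → ℕ) → sumFromTo a a f ≡ f a
sumFromTo-single a f = begin
  sumFromTo a a f              ≡⟨ sumFromTo≡∑ a a f ⟩
  ∑[ t < suc a ∸ a ] f (a + t) ≡⟨ cong (λ k → ∑[ t < k ] f (a + t)) 1+a∸a≡1 ⟩
  f (a + 0) + 0                ≡⟨ trans (+-identityʳ _) (cong f (+-identityʳ a)) ⟩
  f a                          ∎
  where
  open ≡-Reasoning
  1+a∸a≡1 : suc a ∸ a ≡ 1
  1+a∸a≡1 = trans (+-∸-assoc 1 (≤-refl {a})) (cong suc (n∸n≡0 a))

sumFromTo-empty : ∀ a (f : ℕ → ℕ) → sumFromTo (suc a) a f ≡ 0
sumFromTo-empty a f = trans (sumFromTo≡∑ (suc a) a f) (cong (λ k → ∑[ t < k ] f (suc a + t)) (n∸n≡0 a))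

sum-map-tabulate : ∀ {A : Set} k (h : Fin k → A) (g : A → ℕ) (f : ℕ → ℕ) →
  (∀ i → g (h i) ≡ f (toℕ i)) → sum (map g (tabulate h)) ≡ ∑< k f
sum-map-tabulate zero    h g f eq = refl
sum-map-tabulate (suc k) h g f eq =
  cong₂ _+_ (eq fzero) (sum-map-tabulate k (h ∘ fsuc) g (f ∘ suc) (eq ∘ fsuc))

sum-map-allFin : ∀ k (g : Fin k → ℕ) (f : ℕ → ℕ) →
  (∀ i → g i ≡ f (toℕ i)) → sum (map g (allFin k)) ≡ ∑< k f
sum-map-allFin k = sum-map-tabulate k (λ i → i)

infixr 7 [_]·_
[_]·_ : {P : Set} → Dec P → ℕ → ℕ
[ d ]· v = if does d then v else 0

[]·-yes : {P : Set} (d : Dec P) (v : ℕ) → P → [ d ]· v ≡ v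
[]·-yes (yes _) v _ = refl
[]·-yes (no ¬p) v p = contradiction p ¬p

[]·-no : {P : Set} (d : Dec P) (v : ℕ) → ¬ P → [ d ]· v ≡ 0
[]·-no (yes p) v ¬p = contradiction p ¬p
[]·-no (no _)  v _  = refl

[]·-≡0 : {P : Set} (d : Dec P) {v : ℕ} → v ≡ 0 → [ d ]· v ≡ 0
[]·-≡0 (yes _) v≡0 = v≡0
[]·-≡0 (no _)  v≡0 = refl

[]·-comm : {P Q : Set} (d : Dec P) (e : Dec Q) (v : ℕ) → [ d ]· [ e ]· v ≡ [ e ]· [ d ]· v
[]·-comm (yes _) e       v = refl
[]·-comm (no _)  (yes _) v = refl
[]·-comm (no _)  (no _)  v = refl

[]·-distrib-+ : {P : Set} (d : Dec P) (u v : ℕ) → [ d ]· (u + v) ≡ [ d ]· u + [ d ]· v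
[]·-distrib-+ (yes _) u v = refl
[]·-distrib-+ (no _)  u v = refl

∑-[]· : ∀ k {P : Set} (d : Dec P) (f : ℕ → ℕ) → ∑[ t < k ] ([ d ]· f t) ≡ [ d ]· ∑< k f
∑-[]· k (yes _) f = refl
∑-[]· k (no _)  f = ∑-≡0 k (λ _ _ → refl)

[]·-by : {P : Set} (d : Dec P) {v : ℕ} → (P → v ≡ 0) → [ d ]· v ≡ 0
[]·-by (yes p) v≡0 = v≡0 p
[]·-by (no _)  v≡0 = refl

[<]-split : ∀ y b v → [ y <? b ]· v ≡ [ suc y ≟ b ]· v + [ suc y <? b ]· v
[<]-split y b v with <-cmp (suc y) b
... | tri< 1+y<b 1+y≢b _ = trans ([]·-yes (y <? b) v (<-trans (n<1+n y) 1+y<b))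
                                 (sym (cong₂ _+_ ([]·-no (suc y ≟ b) v 1+y≢b) ([]·-yes (suc y <? b) v 1+y<b)))
... | tri≈ 1+y≮b 1+y≡b _ = trans ([]·-yes (y <? b) v (≤-reflexive 1+y≡b))
                                 (sym (trans (cong₂ _+_ ([]·-yes (suc y ≟ b) v 1+y≡b) ([]·-no (suc y <? b) v 1+y≮b))
                                             (+-identityʳ v)))
... | tri> _ 1+y≢b b<1+y = trans ([]·-no (y <? b) v (<⇒≱ b<1+y))
                                 (sym (cong₂ _+_ ([]·-no (suc y ≟ b) v 1+y≢b)
                                                 ([]·-no (suc y <? b) v (<⇒≱ (<-trans b<1+y (n<1+n (suc y)))))))

[≤]-suc : ∀ lo x v → [ suc lo ≤? suc x ]· v ≡ [ lo ≤? x ]· v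
[≤]-suc zero     x v = refl
[≤]-suc (suc lo) x v = refl

∑-from : ∀ N lo (h : ℕ → ℕ) → ∑[ x < N ] ([ lo ≤? x ]· h x) ≡ ∑[ t < N ∸ lo ] h (lo + t)
∑-from N       zero     h = refl
∑-from zero    (suc lo) h = refl
∑-from (suc N) (suc lo) h =
  trans (∑-cong N (λ x _ → [≤]-suc lo x (h (suc x)))) (∑-from N lo (h ∘ suc))

∑-from-split : ∀ N lo (h : ℕ → ℕ) → lo < N →
  ∑[ x < N ] ([ lo ≤? x ]· h x) ≡ h lo + ∑[ x < N ] ([ suc lo ≤? x ]· h x)
∑-from-split N lo h lo<N = begin
  ∑[ x < N ] ([ lo ≤? x ]· h x)                       ≡⟨ ∑-from N lo h ⟩
  ∑[ t < N ∸ lo ] h (lo + t)                        ≡⟨ cong (λ k → ∑< k (h ∘ (lo +_))) (+-∸-assoc 1 lo<N) ⟩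
  h (lo + 0) + ∑[ t < N ∸ suc lo ] h (lo + suc t)   ≡⟨ cong₂ _+_ (cong h (+-identityʳ lo))
                                                          (∑-cong (N ∸ suc lo) (λ t _ → cong h (+-suc lo t))) ⟩
  h lo + ∑[ t < N ∸ suc lo ] h (suc lo + t)         ≡⟨ cong (h lo +_) (∑-from N (suc lo) h) ⟨
  h lo + ∑[ x < N ] ([ suc lo ≤? x ]· h x)            ∎
  where open ≡-Reasoning

∑-head : ∀ N (f : ℕ → ℕ) → 0 < N → (∀ t → f (suc t) ≡ 0) → ∑< N f ≡ f 0
∑-head (suc N) f _ f≡0 = trans (cong (f 0 +_) (∑-≡0 N (λ t _ → f≡0 t))) (+-identityʳ (f 0))

∑-delta : ∀ N x (v : ℕ → ℕ) → x < N → ∑[ j < N ] ([ x ≟ j ]· v j) ≡ v x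
∑-delta N       zero    v 0<N = ∑-head N (λ j → [ 0 ≟ j ]· v j) 0<N (λ _ → refl)
∑-delta (suc N) (suc x) v (s≤s x<N) = ∑-delta N x (v ∘ suc) x<N

count : ∀ {A : Set} {P : Pred A 0ℓ} → Decidable P → List A → ℕ
count P? xs = length (filter P? xs)

count-≐ : ∀ {A : Set} {P Q : Pred A 0ℓ} (P? : Decidable P) (Q? : Decidable Q) →
  P ≐ Q → ∀ xs → count P? xs ≡ count Q? xs
count-≐ P? Q? P≐Q xs = cong length (filter-≐ P? Q? P≐Q xs)

count-none : ∀ {A : Set} {P : Pred A 0ℓ} (P? : Decidable P) → (∀ x → ¬ P x) → ∀ xs → count P? xs ≡ 0
count-none P? ¬P xs = cong length (filter-none P? (All.universal ¬P xs))

count-map : ∀ {A B : Set} {P : Pred B 0ℓ} (P? : Decidable P) (f : A → B) →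
  ∀ xs → count P? (map f xs) ≡ count (P? ∘ f) xs
count-map P? f []       = refl
count-map P? f (x ∷ xs) with does (P? (f x))
... | true  = cong suc (count-map P? f xs)
... | false = count-map P? f xs

count-concatMap : ∀ {A B : Set} {P : Pred B 0ℓ} (P? : Decidable P) (g : A → List B) →
  ∀ xs → count P? (concatMap g xs) ≡ sum (map (count P? ∘ g) xs)
count-concatMap P? g []       = refl
count-concatMap P? g (x ∷ xs) = begin
  length (filter P? (g x ++ concatMap g xs))                 ≡⟨ cong length (filter-++ P? (g x) _) ⟩
  length (filter P? (g x) ++ filter P? (concatMap g xs))     ≡⟨ length-++ (filter P? (g x)) ⟩
  count P? (g x) + count P? (concatMap g xs)                 ≡⟨ cong (count P? (g x) +_) (count-concatMap P? g xs) ⟩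
  count P? (g x) + sum (map (count P? ∘ g) xs)               ∎
  where open ≡-Reasoning

sum-map-concatMap : ∀ {A B : Set} (f : B → ℕ) (g : A → List B) →
  ∀ xs → sum (map f (concatMap g xs)) ≡ sum (map (sum ∘ map f ∘ g) xs)
sum-map-concatMap f g []       = refl
sum-map-concatMap f g (x ∷ xs) = begin
  sum (map f (g x ++ concatMap g xs))                     ≡⟨ cong sum (map-++ f (g x) _) ⟩
  sum (map f (g x) ++ map f (concatMap g xs))             ≡⟨ sum-++ (map f (g x)) _ ⟩
  sum (map f (g x)) + sum (map f (concatMap g xs))         ≡⟨ cong (sum (map f (g x)) +_) (sum-map-concatMap f g xs) ⟩
  sum (map f (g x)) + sum (map (sum ∘ map f ∘ g) xs)       ∎
  where open ≡-Reasoning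

-- Ballot numbers

-- ballot L t counts the ±1 paths of length L from height t down to 0 that stay ≥ 0.
ballot : ℕ → ℕ → ℕ
ballot zero    zero    = 1
ballot zero    (suc t) = 0
ballot (suc L) zero    = ballot L 1
ballot (suc L) (suc t) = ballot L (suc (suc t)) + ballot L t

ballot-unreachable : ∀ L t → L < t → ballot L t ≡ 0
ballot-unreachable zero    (suc t) _         = refl
ballot-unreachable (suc L) (suc t) (s≤s L<t) =
  cong₂ _+_ (ballot-unreachable L (2 + t) (m<n⇒m<1+n (m<n⇒m<1+n L<t))) (ballot-unreachable L t L<t)

ballot-diagonal : ∀ t → ballot t t ≡ 1
ballot-diagonal zero    = refl
ballot-diagonal (suc t) = cong₂ _+_ (ballot-unreachable t (2 + t) (m<n⇒m<1+n (n<1+n t))) (ballot-diagonal t)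

infixl 6.5 _C⁻_
_C⁻_ : ℕ → ℕ → ℕ
L C⁻ zero  = 0
L C⁻ suc k = L C k

pascal : ∀ L k → suc L C suc k ≡ L C k + L C suc k
pascal L k = sym (nCk+nC[k+1]≡[n+1]C[k+1] L k)

pascal⁻ : ∀ L k → suc L C k ≡ L C⁻ k + L C k
pascal⁻ L zero    = refl
pascal⁻ L (suc k) = pascal L k

ballot-binomial : ∀ L k t → k + k + t ≡ L → ballot L t + L C⁻ k ≡ L C k
ballot-binomial zero    zero    zero    refl = refl
ballot-binomial (suc L) zero    (suc t) 1+t≡1+L = begin
  ballot L (2 + t) + ballot L t + 0
    ≡⟨ cong₂ (λ u v → u + v + 0) (ballot-unreachable L (2 + t) L<2+t) (cong (ballot L) t≡L) ⟩
  0 + ballot L L + 0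
    ≡⟨ cong (_+ 0) (ballot-diagonal L) ⟩
  1
    ∎
  where
  open ≡-Reasoning
  t≡L = suc-injective 1+t≡1+L
  L<2+t = ≤-trans (s≤s (≤-reflexive (sym t≡L))) (n≤1+n (suc t))
ballot-binomial (suc .(k + suc k + 0)) (suc k) zero refl = begin
  ballot L 1 + suc L C k        ≡⟨ cong (ballot L 1 +_) (pascal⁻ L k) ⟩
  ballot L 1 + (L C⁻ k + L C k) ≡⟨ +-assoc (ballot L 1) _ _ ⟨
  ballot L 1 + L C⁻ k + L C k   ≡⟨ cong (_+ L C k) (ballot-binomial L k 1 (k+k+1≡L k)) ⟩
  L C k + L C k                 ≡⟨ cong (L C k +_) (trans (nCk≡nC[n∸k] k≤L) (cong (L C_) L∸k≡1+k)) ⟩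
  L C k + L C suc k             ≡⟨ pascal L k ⟨
  suc L C suc k                 ∎
  where
  open ≡-Reasoning
  L = k + suc k + 0
  k+k+1≡L : ∀ k → k + k + 1 ≡ k + suc k + 0
  k+k+1≡L = solve-∀
  k≤L : k ≤ L
  k≤L = ≤-trans (m≤m+n k (suc k)) (m≤m+n _ 0)
  L∸k≡1+k : L ∸ k ≡ suc k
  L∸k≡1+k = trans (cong (_∸ k) (+-identityʳ (k + suc k))) (m+n∸m≡n k (suc k))
ballot-binomial (suc .(k + suc k + suc t)) (suc k) (suc t) refl = begin
  ballot L (2 + t) + ballot L t + suc L C k                 ≡⟨ cong (ballot L (2 + t) + ballot L t +_) (pascal⁻ L k) ⟩
  ballot L (2 + t) + ballot L t + (L C⁻ k + L C k)          ≡⟨ +-interchange (ballot L (2 + t)) (ballot L t) _ _ ⟩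
  (ballot L (2 + t) + L C⁻ k) + (ballot L t + L C⁻ suc k)   ≡⟨ cong₂ _+_ (ballot-binomial L k (2 + t) (shift₁ k t))
                                                                         (ballot-binomial L (suc k) t (shift₂ k t)) ⟩
  L C k + L C suc k                                          ≡⟨ pascal L k ⟨
  suc L C suc k                                              ∎
  where
  open ≡-Reasoning
  L = k + suc k + suc t
  shift₁ : ∀ k t → k + k + (2 + t) ≡ k + suc k + suc t
  shift₁ = solve-∀
  shift₂ : ∀ k t → suc k + suc k + t ≡ k + suc k + suc t
  shift₂ = solve-∀

[1+k]*[1+m]C[1+k]≡[1+m]*mCk : ∀ m k → suc k * (suc m C suc k) ≡ suc m * (m C k)
[1+k]*[1+m]C[1+k]≡[1+m]*mCk zero    zero    = refl
[1+k]*[1+m]C[1+k]≡[1+m]*mCk zero    (suc k) = *-zeroʳ (2 + k)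
[1+k]*[1+m]C[1+k]≡[1+m]*mCk (suc m) zero    = trans (+-identityʳ _) (trans (nC1≡n (2 + m)) (sym (*-identityʳ (2 + m))))
[1+k]*[1+m]C[1+k]≡[1+m]*mCk (suc m) (suc k) = begin
  (2 + k) * (suc (suc m) C suc (suc k))  ≡⟨ cong ((2 + k) *_) (pascal (suc m) (suc k)) ⟩
  (2 + k) * (X + Y)                      ≡⟨ expand k X Y ⟩
  X + (1 + k) * X + (2 + k) * Y          ≡⟨ cong₂ (λ u v → X + u + v) ([1+k]*[1+m]C[1+k]≡[1+m]*mCk m k)
                                                                    ([1+k]*[1+m]C[1+k]≡[1+m]*mCk m (suc k)) ⟩
  X + suc m * (m C k) + suc m * (m C suc k) ≡⟨ collect X (suc m) (m C k) (m C suc k) ⟩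
  X + suc m * (m C k + m C suc k)        ≡⟨ cong (λ z → X + suc m * z) (pascal m k) ⟨
  X + suc m * X                          ≡⟨⟩
  suc (suc m) * X                        ∎
  where
  open ≡-Reasoning
  X = suc m C suc k
  Y = suc m C suc (suc k)
  expand : ∀ k X Y → (2 + k) * (X + Y) ≡ X + (1 + k) * X + (2 + k) * Y
  expand = solve-∀
  collect : ∀ X s a b → X + s * a + s * b ≡ X + s * (a + b)
  collect = solve-∀

[1+p]*C[2+2p,1+p]≡[2+p]*C[2+2p,p] : ∀ p → suc p * ((suc p + suc p) C suc p) ≡ suc (suc p) * ((suc p + suc p) C p)
[1+p]*C[2+2p,1+p]≡[2+p]*C[2+2p,p] p = begin
  suc p * (suc N C suc p)              ≡⟨ [1+k]*[1+m]C[1+k]≡[1+m]*mCk N p ⟩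
  suc N * (N C p)                      ≡⟨ cong (suc N *_) symmetric₁ ⟨
  suc N * (N C suc p)                  ≡⟨ [1+k]*[1+m]C[1+k]≡[1+m]*mCk N (suc p) ⟨
  suc (suc p) * (suc N C suc (suc p))  ≡⟨ cong (suc (suc p) *_) symmetric ⟨
  suc (suc p) * (suc N C p)            ∎
  where
  open ≡-Reasoning
  N = p + suc p
  symmetric₁ : N C suc p ≡ N C p
  symmetric₁ = trans (nCk≡nC[n∸k] (m≤n+m (suc p) p)) (cong (N C_) (m+n∸n≡m p (suc p)))
  symmetric : suc N C p ≡ suc N C suc (suc p)
  symmetric = trans (nCk≡nC[n∸k] (≤-trans (m≤m+n p (suc p)) (n≤1+n N)))
                    (cong (suc N C_) (trans (+-∸-assoc 1 (m≤m+n p (suc p))) (cong suc (m+n∸m≡n p (suc p)))))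

-- Ballot numbers at the centre: C(2n, n) − C(2n, n − 1) = C(2n, n) / (n + 1).
Catalan≡ballot : ∀ p → Catalan (suc p) ≡ ballot (suc p + suc p) 0
Catalan≡ballot p = begin
  ((2 * n) C n) / suc n  ≡⟨ cong (λ m → (m C n) / suc n) (cong (n +_) (+-identityʳ n)) ⟩
  Cₙ / suc n             ≡⟨ cong (_/ suc n) ballot*[1+n]≡Cₙ ⟨
  (B * suc n) / suc n    ≡⟨ m*n/n≡m B (suc n) ⟩
  B                      ∎
  where
  open ≡-Reasoning
  n = suc p
  B = ballot (n + n) 0
  Cₙ = (n + n) C n
  Cₚ = (n + n) C p
  ballot*[1+n]≡Cₙ : B * suc n ≡ Cₙ
  ballot*[1+n]≡Cₙ = +-cancelʳ-≡ (suc n * Cₚ) (B * suc n) Cₙ (begin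
    B * suc n + suc n * Cₚ  ≡⟨ cong (_+ suc n * Cₚ) (*-comm B (suc n)) ⟩
    suc n * B + suc n * Cₚ  ≡⟨ *-distribˡ-+ (suc n) B Cₚ ⟨
    suc n * (B + Cₚ)        ≡⟨ cong (suc n *_) (ballot-binomial (n + n) n 0 (+-identityʳ (n + n))) ⟩
    Cₙ + n * Cₙ             ≡⟨ cong (Cₙ +_) ([1+p]*C[2+2p,1+p]≡[2+p]*C[2+2p,p] p) ⟩
    Cₙ + suc n * Cₚ         ∎)

ballot′ : ℕ → ℕ → ℕ
ballot′ a h = ballot (suc (a + a + h)) (suc h)

ballot′-rec : ∀ a h → ballot′ (suc a) h ≡ ballot′ a (suc h) + ∑[ h′ < suc h ] ballot′ a h′
ballot′-rec a zero =
  cong₂ _+_ (cong (λ L → ballot (suc L) 2) (shift₁ a))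
            (trans (cong (λ L → ballot L 1) (shift₂ a)) (sym (+-identityʳ _)))
  where
  shift₁ : ∀ a → a + (1 + a) + 0 ≡ a + a + 1
  shift₁ = solve-∀
  shift₂ : ∀ a → a + (1 + a) + 0 ≡ 1 + (a + a + 0)
  shift₂ = solve-∀
ballot′-rec a (suc h) = begin
  ballot L (3 + h) + ballot L (suc h)
    ≡⟨ cong₂ _+_ (cong (λ L → ballot L (3 + h)) (shift₁ a h)) (cong (λ L → ballot L (suc h)) (shift₂ a h)) ⟩
  ballot′ a (2 + h) + ballot′ (suc a) h
    ≡⟨ cong (ballot′ a (2 + h) +_) (ballot′-rec a h) ⟩
  ballot′ a (2 + h) + (ballot′ a (suc h) + ∑[ h′ < suc h ] ballot′ a h′)
    ≡⟨ cong (ballot′ a (2 + h) +_) (+-comm (ballot′ a (suc h)) _) ⟩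
  ballot′ a (2 + h) + (∑[ h′ < suc h ] ballot′ a h′ + ballot′ a (suc h))
    ≡⟨ cong (ballot′ a (2 + h) +_) (∑-last (suc h) (ballot′ a)) ⟨
  ballot′ a (2 + h) + ∑[ h′ < 2 + h ] ballot′ a h′
    ∎
  where
  open ≡-Reasoning
  L = suc (a + suc a + suc h)
  shift₁ : ∀ a h → 1 + (a + (1 + a) + (1 + h)) ≡ 1 + (a + a + (2 + h))
  shift₁ = solve-∀
  shift₂ : ∀ a h → 1 + (a + (1 + a) + (1 + h)) ≡ 1 + ((1 + a) + (1 + a) + h)
  shift₂ = solve-∀

-- Indexing matrices as chains of columns

infix 4 _⊏_
_⊏_ : ℕ → ℕ → Set
y ⊏ b = y < b ⊎ (y ≡ 0 × b ≡ 0)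

_⊏?_ : ∀ y b → Dec (y ⊏ b)
y ⊏? b = (y <? b) ⊎-dec ((y ≟ 0) ×-dec (b ≟ 0))

0⊏ : ∀ b → 0 ⊏ b
0⊏ zero    = inj₂ (refl , refl)
0⊏ (suc b) = inj₁ (s≤s z≤n)

⊏-trans : ∀ {x y z} → x ⊏ y → y ⊏ z → x ⊏ z
⊏-trans (inj₁ x<y)           (inj₁ y<z)           = inj₁ (<-trans x<y y<z)
⊏-trans (inj₁ x<y)           (inj₂ (refl , _))    = contradiction x<y λ ()
⊏-trans (inj₂ (refl , refl)) y⊏z                  = y⊏z

⊏⇒≤ : ∀ {y b} → y ⊏ b → y ≤ b
⊏⇒≤ (inj₁ y<b)          = <⇒≤ y<b
⊏⇒≤ (inj₂ (refl , refl)) = z≤n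

⊏-pos : ∀ {y b} → 1 ≤ y → y ⊏ b → y < b
⊏-pos _      (inj₁ y<b)       = y<b
⊏-pos 1≤0    (inj₂ (refl , _)) = contradiction 1≤0 λ ()

-- IndexingAfter lo y A: A satisfies the indexing conditions and can follow a column (a , y)
-- with a < lo.
IndexingAfter : ∀ {n m} → ℕ → ℕ → Matrix n m → Set
IndexingAfter lo y []            = ⊤
IndexingAfter lo y ((a , b) ∷ A) =
  lo ≤ toℕ a × toℕ b ≤ toℕ a × y ⊏ toℕ b × IndexingAfter (suc (toℕ a)) (toℕ b) A

indexingAfter? : ∀ {n m} lo y (A : Matrix n m) → Dec (IndexingAfter lo y A)
indexingAfter? lo y []            = yes tt
indexingAfter? lo y ((a , b) ∷ A) =
  (lo ≤? toℕ a) ×-dec (toℕ b ≤? toℕ a) ×-dec (y ⊏? toℕ b) ×-dec indexingAfter? (suc (toℕ a)) (toℕ b) A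

module _ {n m : ℕ} {a b : Fin n} {A : Matrix n m} where

  IsIndexing-tail : IsIndexing ((a , b) ∷ A) → IsIndexing A
  IsIndexing-tail (i₁ , i₂ , i₃ , i₄) =
    (λ j k j<k → i₁ (fsuc j) (fsuc k) (s≤s j<k)) , (λ j k j<k → i₂ (fsuc j) (fsuc k) (s≤s j<k)) ,
    (λ j k j<k → i₃ (fsuc j) (fsuc k) (s≤s j<k)) , (λ j → i₄ (fsuc j))

  IsIndexing-∷ : toℕ b ≤ toℕ a → (∀ j → toℕ a < a1 A j) → (∀ j → toℕ b ⊏ a2 A j) →
    IsIndexing A → IsIndexing ((a , b) ∷ A)
  IsIndexing-∷ b≤a a< b⊏ (i₁ , i₂ , i₃ , i₄) = j₁ , j₂ , j₃ , j₄
    where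
    j₁ : ∀ j k → j <ᶠ k → a1 ((a , b) ∷ A) j < a1 ((a , b) ∷ A) k
    j₁ fzero    (fsuc k) _         = a< k
    j₁ (fsuc j) (fsuc k) (s≤s j<k) = i₁ j k j<k
    j₂ : ∀ j k → j <ᶠ k → a2 ((a , b) ∷ A) j ≤ a2 ((a , b) ∷ A) k
    j₂ fzero    (fsuc k) _         = ⊏⇒≤ (b⊏ k)
    j₂ (fsuc j) (fsuc k) (s≤s j<k) = i₂ j k j<k
    j₃ : ∀ j k → j <ᶠ k → a2 ((a , b) ∷ A) j ≡ a2 ((a , b) ∷ A) k →
      a2 ((a , b) ∷ A) j ≡ 0 × a2 ((a , b) ∷ A) k ≡ 0
    j₃ fzero    (fsuc k) _ eq with b⊏ k
    ... | inj₁ b<k   = contradiction eq (<⇒≢ b<k)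
    ... | inj₂ zeros = zeros
    j₃ (fsuc j) (fsuc k) (s≤s j<k) eq = i₃ j k j<k eq
    j₄ : ∀ j → a2 ((a , b) ∷ A) j ≤ a1 ((a , b) ∷ A) j
    j₄ fzero    = b≤a
    j₄ (fsuc j) = i₄ j

IsIndexing⇒IndexingAfter : ∀ {n m} {A : Matrix n m} lo y →
  IsIndexing A → (∀ j → lo ≤ a1 A j) → (∀ j → y ⊏ a2 A j) → IndexingAfter lo y A
IsIndexing⇒IndexingAfter {A = []}          lo y _ _ _ = tt
IsIndexing⇒IndexingAfter {A = (a , b) ∷ A} lo y I@(i₁ , i₂ , i₃ , i₄) lo≤ y⊏ =
  lo≤ fzero , i₄ fzero , y⊏ fzero ,
  IsIndexing⇒IndexingAfter (suc (toℕ a)) (toℕ b) (IsIndexing-tail I)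
    (λ j → i₁ fzero (fsuc j) (s≤s z≤n)) b⊏
  where
  b⊏ : ∀ j → toℕ b ⊏ a2 A j
  b⊏ j with m≤n⇒m<n∨m≡n (i₂ fzero (fsuc j) (s≤s z≤n))
  ... | inj₁ b<bⱼ = inj₁ b<bⱼ
  ... | inj₂ b≡bⱼ = inj₂ (i₃ fzero (fsuc j) (s≤s z≤n) b≡bⱼ)

IndexingAfter⇒IsIndexing : ∀ {n m} {A : Matrix n m} lo y → IndexingAfter lo y A →
  IsIndexing A × (∀ j → lo ≤ a1 A j) × (∀ j → y ⊏ a2 A j)
IndexingAfter⇒IsIndexing {A = []} lo y _ = ((λ ()) , (λ ()) , (λ ()) , (λ ())) , (λ ()) , (λ ())
IndexingAfter⇒IsIndexing {A = (a , b) ∷ A} lo y (lo≤a , b≤a , y⊏b , after)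
  with IndexingAfter⇒IsIndexing (suc (toℕ a)) (toℕ b) after
... | I , a< , b⊏ = IsIndexing-∷ b≤a a< b⊏ I , lo≤ , y⊏
  where
  lo≤ : ∀ j → lo ≤ a1 ((a , b) ∷ A) j
  lo≤ fzero    = lo≤a
  lo≤ (fsuc j) = ≤-trans lo≤a (<⇒≤ (a< j))
  y⊏ : ∀ j → y ⊏ a2 ((a , b) ∷ A) j
  y⊏ fzero    = y⊏b
  y⊏ (fsuc j) = ⊏-trans y⊏b (b⊏ j)

IsIndexing⇔IndexingAfter₀ : ∀ {n m} {A : Matrix n m} → IsIndexing A ⇔ IndexingAfter 0 0 A
IsIndexing⇔IndexingAfter₀ {A = A} = mk⇔
  (λ I → IsIndexing⇒IndexingAfter 0 0 I (λ _ → z≤n) (λ j → 0⊏ (a2 A j)))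
  (λ after → proj₁ (IndexingAfter⇒IsIndexing 0 0 after))

blobRank-tail : ∀ {n m} (c : Column n) (A : Matrix n m) →
  count (containsZero? ∘ lookup (c ∷ A)) (tabulate {n = m} fsuc) ≡ blobRank A
blobRank-tail {m = m} c A = trans (cong (count (containsZero? ∘ lookup (c ∷ A))) (sym (map-tabulate (λ i → i) fsuc)))
                                  (count-map (containsZero? ∘ lookup (c ∷ A)) fsuc (allFin m))

blobRank-∷-zero : ∀ {n m} {c : Column n} (A : Matrix n m) → ContainsZero c → blobRank (c ∷ A) ≡ suc (blobRank A)
blobRank-∷-zero {c = c} A z =
  trans (cong length (filter-accept (containsZero? ∘ lookup (c ∷ A)) {x = fzero} {xs = tabulate fsuc} z))
        (cong suc (blobRank-tail c A))

blobRank-∷-nonzero : ∀ {n m} {c : Column n} (A : Matrix n m) → ¬ ContainsZero c → blobRank (c ∷ A) ≡ blobRank A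
blobRank-∷-nonzero {c = c} A ¬z =
  trans (cong length (filter-reject (containsZero? ∘ lookup (c ∷ A)) {x = fzero} {xs = tabulate fsuc} ¬z))
        (blobRank-tail c A)

IndexingAfter-positive : ∀ {n m} {A : Matrix n m} lo y → 1 ≤ y → IndexingAfter lo y A → Positive A
IndexingAfter-positive {A = (a , b) ∷ A} lo y 1≤y (_ , b≤a , y⊏b , after) fzero =
  <-≤-trans 0<b b≤a , 0<b
  where 0<b = <-trans 1≤y (⊏-pos 1≤y y⊏b)
IndexingAfter-positive {A = (a , b) ∷ A} lo y 1≤y (_ , _ , y⊏b , after) (fsuc j) =
  IndexingAfter-positive (suc (toℕ a)) (toℕ b) (<-trans 1≤y (⊏-pos 1≤y y⊏b)) after j

IndexingAfter-blobRank : ∀ {n m} {A : Matrix n m} lo y → 1 ≤ y → IndexingAfter lo y A → blobRank A ≡ 0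
IndexingAfter-blobRank {A = []}          lo y 1≤y _ = refl
IndexingAfter-blobRank {A = (a , b) ∷ A} lo y 1≤y (_ , b≤a , y⊏b , after) =
  trans (blobRank-∷-nonzero A nonzero) (IndexingAfter-blobRank (suc (toℕ a)) (toℕ b) 1≤b after)
  where
  1≤b : 1 ≤ toℕ b
  1≤b = <-trans 1≤y (⊏-pos 1≤y y⊏b)
  nonzero : ¬ ContainsZero (a , b)
  nonzero (inj₁ a≡0) = <⇒≢ (<-≤-trans 1≤b b≤a) (sym a≡0)
  nonzero (inj₂ b≡0) = <⇒≢ 1≤b (sym b≡0)

-- Counting chains by their first column

-- afterHead F y b d r: the tails of blob-rank r behind a first column (x , b) that follows a
-- second entry y, where F b′ r′ counts the tails behind (x , b′); (x , 0) after a 0 is a blob.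
afterHead : (ℕ → ℕ → ℕ) → ∀ y b → Dec (y < b) → ℕ → ℕ
afterHead F y    b    (yes _) r       = F b r
afterHead F zero zero (no _)  (suc r) = F 0 r
afterHead F _    _    (no _)  _       = 0

headTerm : (ℕ → ℕ → ℕ → ℕ) → (lo y r x b : ℕ) → ℕ
headTerm N lo y r x b = [ lo ≤? x ]· [ b ≤? x ]· afterHead (N (suc x)) y b (y <? b) r

afterHead-cong : ∀ {F G : ℕ → ℕ → ℕ} y b d r → (∀ b' r' → F b' r' ≡ G b' r') →
  afterHead F y b d r ≡ afterHead G y b d r
afterHead-cong y    b    (yes _) r       F≗G = F≗G b r
afterHead-cong zero zero (no _)  (suc r) F≗G = F≗G 0 r
afterHead-cong zero zero (no _)  zero    F≗G = refl
afterHead-cong zero (suc b) (no _) r     F≗G = refl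
afterHead-cong (suc y) b (no _)  r       F≗G = refl

∑-afterHead : ∀ k (F : ℕ → ℕ → ℕ → ℕ) y b d r →
  ∑[ t < k ] afterHead (F t) y b d r ≡ afterHead (λ b' r' → ∑[ t < k ] F t b' r') y b d r
∑-afterHead k F y    b    (yes _) r       = refl
∑-afterHead k F zero zero (no _)  (suc r) = refl
∑-afterHead k F zero zero (no _)  zero    = ∑-≡0 k (λ _ _ → refl)
∑-afterHead k F zero (suc b) (no _) r     = ∑-≡0 k (λ _ _ → refl)
∑-afterHead k F (suc y) b (no _)  r       = ∑-≡0 k (λ _ _ → refl)

afterHead-rank0 : ∀ (F : ℕ → ℕ → ℕ) y b d → afterHead F y b d 0 ≡ [ d ]· F b 0
afterHead-rank0 F y       b       (yes _) = refl
afterHead-rank0 F zero    zero    (no _)  = refl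
afterHead-rank0 F zero    (suc b) (no _)  = refl
afterHead-rank0 F (suc y) b       (no _)  = refl

afterHead-≡0 : ∀ {F : ℕ → ℕ → ℕ} y b d r → (∀ b' r' → F b' r' ≡ 0) → afterHead F y b d r ≡ 0
afterHead-≡0 y       b       (yes _) r       F≡0 = F≡0 b r
afterHead-≡0 zero    zero    (no _)  (suc r) F≡0 = F≡0 0 r
afterHead-≡0 zero    zero    (no _)  zero    F≡0 = refl
afterHead-≡0 zero    (suc b) (no _)  r       F≡0 = refl
afterHead-≡0 (suc y) b       (no _)  r       F≡0 = refl

afterHead-positive : ∀ {F : ℕ → ℕ → ℕ} y b d r → (y < b → F b r ≡ 0) → afterHead F (suc y) b d r ≡ 0
afterHead-positive y b (yes y<b) r F≡0 = F≡0 (<-trans (n<1+n y) y<b)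
afterHead-positive y b (no _)    r F≡0 = refl

headTerm-cong : ∀ {N M : ℕ → ℕ → ℕ → ℕ} lo y r x b → (∀ b' r' → N (suc x) b' r' ≡ M (suc x) b' r') →
  headTerm N lo y r x b ≡ headTerm M lo y r x b
headTerm-cong lo y r x b eq =
  cong (λ v → [ lo ≤? x ]· [ b ≤? x ]· v) (afterHead-cong y b (y <? b) r eq)

∑-headTerm : ∀ k (N : ℕ → ℕ → ℕ → ℕ → ℕ) lo y r x b →
  ∑[ t < k ] headTerm (N t) lo y r x b ≡ headTerm (λ lo' y' r' → ∑[ t < k ] N t lo' y' r') lo y r x b
∑-headTerm k N lo y r x b = begin
  ∑[ t < k ] ([ lo ≤? x ]· [ b ≤? x ]· afterHead (N t (suc x)) y b (y <? b) r)
    ≡⟨ ∑-[]· k (lo ≤? x) _ ⟩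
  [ lo ≤? x ]· ∑[ t < k ] ([ b ≤? x ]· afterHead (N t (suc x)) y b (y <? b) r)
    ≡⟨ cong ([ lo ≤? x ]·_) (∑-[]· k (b ≤? x) _) ⟩
  [ lo ≤? x ]· [ b ≤? x ]· ∑[ t < k ] afterHead (N t (suc x)) y b (y <? b) r
    ≡⟨ cong (λ v → [ lo ≤? x ]· [ b ≤? x ]· v) (∑-afterHead k (λ t → N t (suc x)) y b (y <? b) r) ⟩
  headTerm (λ lo' y' r' → ∑[ t < k ] N t lo' y' r') lo y r x b
    ∎
  where open ≡-Reasoning

module _ (n : ℕ) where

  count-byHead : ∀ m {P : Pred (Matrix n (suc m)) 0ℓ} (P? : Decidable P) (f : ℕ → ℕ → ℕ) →
    (∀ x b → count (P? ∘ ((x , b) ∷_)) (allMatrices n m) ≡ f (toℕ x) (toℕ b)) →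
    count P? (allMatrices n (suc m)) ≡ ∑[ x < n ] ∑[ b < n ] f x b
  count-byHead m P? f eq = begin
    count P? (concatMap (λ c → map (c ∷_) (allMatrices n m)) columns)
      ≡⟨ count-concatMap P? (λ c → map (c ∷_) (allMatrices n m)) columns ⟩
    sum (map (λ c → count P? (map (c ∷_) (allMatrices n m))) columns)
      ≡⟨ cong sum (map-cong (λ c → count-map P? (c ∷_) (allMatrices n m)) columns) ⟩
    sum (map countWithHead columns)
      ≡⟨ sum-map-concatMap countWithHead (λ x → map (x ,_) (allFin n)) (allFin n) ⟩
    sum (map (λ x → sum (map countWithHead (map (x ,_) (allFin n)))) (allFin n))
      ≡⟨ sum-map-allFin n _ _ (λ x → trans (cong sum (sym (map-∘ (allFin n))))
                                            (sum-map-allFin n _ (f (toℕ x)) (eq x))) ⟩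
    ∑[ x < n ] ∑[ b < n ] f x b
      ∎
    where
    open ≡-Reasoning
    columns : List (Column n)
    columns = concatMap (λ x → map (x ,_) (allFin n)) (allFin n)
    countWithHead : Column n → ℕ
    countWithHead c = count (P? ∘ (c ∷_)) (allMatrices n m)

  indexingCount : (m lo y r : ℕ) → ℕ
  indexingCount m lo y r = count (λ A → indexingAfter? lo y A ×-dec (blobRank A ≟ r)) (allMatrices n m)

  chains : (m lo y r : ℕ) → ℕ
  chains zero    lo y zero    = 1
  chains zero    lo y (suc r) = 0
  chains (suc m) lo y r       = ∑[ x < n ] ∑[ b < n ] headTerm (chains m) lo y r x b

  HeadedBy : ∀ {m} → ℕ → ℕ → ℕ → Column n → Matrix n m → Set
  HeadedBy lo y r c A = IndexingAfter lo y (c ∷ A) × blobRank (c ∷ A) ≡ r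

  headedBy? : ∀ {m} lo y r c → Decidable (HeadedBy {m} lo y r c)
  headedBy? lo y r c A = indexingAfter? lo y (c ∷ A) ×-dec (blobRank (c ∷ A) ≟ r)

  ascendingHeadCount : ∀ m lo y r (x b : Fin n) → lo ≤ toℕ x → toℕ b ≤ toℕ x → y < toℕ b →
    count (headedBy? lo y r (x , b)) (allMatrices n m) ≡ indexingCount m (suc (toℕ x)) (toℕ b) r
  ascendingHeadCount m lo y r x b lo≤x b≤x y<b = count-≐ (headedBy? lo y r (x , b)) _ (to , from) (allMatrices n m)
    where
    nonzero : ¬ ContainsZero (x , b)
    nonzero (inj₁ x≡0) = <⇒≢ (<-≤-trans (≤-<-trans z≤n y<b) b≤x) (sym x≡0)
    nonzero (inj₂ b≡0) = <⇒≢ (≤-<-trans z≤n y<b) (sym b≡0)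
    to : ∀ {A} → HeadedBy lo y r (x , b) A → IndexingAfter (suc (toℕ x)) (toℕ b) A × blobRank A ≡ r
    to {A} ((_ , _ , _ , after) , rank) = after , trans (sym (blobRank-∷-nonzero A nonzero)) rank
    from : ∀ {A} → IndexingAfter (suc (toℕ x)) (toℕ b) A × blobRank A ≡ r → HeadedBy lo y r (x , b) A
    from {A} (after , rank) = (lo≤x , b≤x , inj₁ y<b , after) , trans (blobRank-∷-nonzero A nonzero) rank

  blobHeadCount : ∀ m lo r (x b : Fin n) → lo ≤ toℕ x → toℕ b ≡ 0 →
    count (headedBy? lo 0 (suc r) (x , b)) (allMatrices n m) ≡ indexingCount m (suc (toℕ x)) 0 r
  blobHeadCount m lo r x b lo≤x b≡0 = count-≐ (headedBy? lo 0 (suc r) (x , b)) _ (to , from) (allMatrices n m)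
    where
    to : ∀ {A} → HeadedBy lo 0 (suc r) (x , b) A → IndexingAfter (suc (toℕ x)) 0 A × blobRank A ≡ r
    to {A} ((_ , _ , _ , after) , rank) =
      subst (λ b' → IndexingAfter (suc (toℕ x)) b' A) b≡0 after ,
      suc-injective (trans (sym (blobRank-∷-zero {c = x , b} A (inj₂ b≡0))) rank)
    from : ∀ {A} → IndexingAfter (suc (toℕ x)) 0 A × blobRank A ≡ r → HeadedBy lo 0 (suc r) (x , b) A
    from {A} (after , rank) =
      (lo≤x , subst (_≤ toℕ x) (sym b≡0) z≤n , 0⊏ (toℕ b) ,
       subst (λ b' → IndexingAfter (suc (toℕ x)) b' A) (sym b≡0) after) ,
      trans (blobRank-∷-zero {c = x , b} A (inj₂ b≡0)) (cong suc rank)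

  nonAscendingHeadCount : ∀ m lo y r (x b : Fin n) →
    (∀ lo' y' r' → indexingCount m lo' y' r' ≡ chains m lo' y' r') → lo ≤ toℕ x → (y≮b : ¬ y < toℕ b) →
    count (headedBy? lo y r (x , b)) (allMatrices n m) ≡ afterHead (chains m (suc (toℕ x))) y (toℕ b) (no y≮b) r
  nonAscendingHeadCount m lo (suc y) r x b IH lo≤x y≮b =
    count-none (headedBy? lo (suc y) r (x , b))
      (λ A p → y≮b (⊏-pos (s≤s z≤n) (proj₁ (proj₂ (proj₂ (proj₁ p)))))) (allMatrices n m)
  nonAscendingHeadCount m lo zero r x b IH lo≤x y≮b = ascendsFromZero r (toℕ b) refl y≮b
    where
    ascendsFromZero : ∀ r b' → toℕ b ≡ b' → (0≮b' : ¬ 0 < b') →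
      count (headedBy? lo 0 r (x , b)) (allMatrices n m) ≡ afterHead (chains m (suc (toℕ x))) 0 b' (no 0≮b') r
    ascendsFromZero r       (suc _) _   0≮b' = contradiction (s≤s z≤n) 0≮b'
    ascendsFromZero zero    zero    b≡0 _    = count-none (headedBy? lo 0 0 (x , b))
      (λ A p → 0≢1+n (trans (sym (proj₂ p)) (blobRank-∷-zero {c = x , b} A (inj₂ b≡0)))) (allMatrices n m)
    ascendsFromZero (suc r) zero    b≡0 _    = trans (blobHeadCount m lo r x b lo≤x b≡0) (IH _ _ _)

  headCount : ∀ m lo y r (x b : Fin n) → (∀ lo' y' r' → indexingCount m lo' y' r' ≡ chains m lo' y' r') →
    count (headedBy? lo y r (x , b)) (allMatrices n m) ≡ headTerm (chains m) lo y r (toℕ x) (toℕ b)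
  headCount m lo y r x b IH = byCases (lo ≤? toℕ x) (toℕ b ≤? toℕ x) (y <? toℕ b)
    where
    byCases : (lo≤?x : Dec (lo ≤ toℕ x)) (b≤?x : Dec (toℕ b ≤ toℕ x)) (y<?b : Dec (y < toℕ b)) →
      count (headedBy? lo y r (x , b)) (allMatrices n m)
        ≡ [ lo≤?x ]· [ b≤?x ]· afterHead (chains m (suc (toℕ x))) y (toℕ b) y<?b r
    byCases (no lo≰x)  _          _         =
      count-none (headedBy? lo y r (x , b)) (λ A p → lo≰x (proj₁ (proj₁ p))) (allMatrices n m)
    byCases (yes _)    (no b≰x)   _         =
      count-none (headedBy? lo y r (x , b)) (λ A p → b≰x (proj₁ (proj₂ (proj₁ p)))) (allMatrices n m)
    byCases (yes lo≤x) (yes b≤x)  (yes y<b) = trans (ascendingHeadCount m lo y r x b lo≤x b≤x y<b) (IH _ _ _)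
    byCases (yes lo≤x) (yes _)    (no y≮b)  = nonAscendingHeadCount m lo y r x b IH lo≤x y≮b

  indexingCount≡chains : ∀ m lo y r → indexingCount m lo y r ≡ chains m lo y r
  indexingCount≡chains zero    lo y zero    = refl
  indexingCount≡chains zero    lo y (suc r) = refl
  indexingCount≡chains (suc m) lo y r       =
    count-byHead m (λ A → indexingAfter? lo y A ×-dec (blobRank A ≟ r)) (headTerm (chains m) lo y r)
      (λ x b → headCount m lo y r x b (indexingCount≡chains m))

  PositiveHeadedBy : ∀ {m} → ℕ → Column n → Matrix n m → Set
  PositiveHeadedBy j c A = IsIndexing (c ∷ A) × Positive (c ∷ A) × c11 (c ∷ A) ≡ j

  positiveHeadedBy? : ∀ {m} j c → Decidable (PositiveHeadedBy {m} j c)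
  positiveHeadedBy? j c A = isIndexing? (c ∷ A) ×-dec positive? (c ∷ A) ×-dec (c11 (c ∷ A) ≟ j)

  θHead : (ℕ → ℕ → ℕ → ℕ) → (j x b : ℕ) → ℕ
  θHead N j x b = [ j ≟ x ]· [ b ≤? x ]· [ 0 <? b ]· N (suc x) b 0

  positiveHeadedCount : ∀ m j (x b : Fin n) → j ≡ toℕ x → 1 ≤ toℕ b → toℕ b ≤ toℕ x →
    count (positiveHeadedBy? j (x , b)) (allMatrices n m) ≡ indexingCount m (suc (toℕ x)) (toℕ b) 0
  positiveHeadedCount m j x b j≡x 1≤b b≤x =
    count-≐ (positiveHeadedBy? j (x , b)) _ (to , from) (allMatrices n m)
    where
    to : ∀ {A} → PositiveHeadedBy j (x , b) A → IndexingAfter (suc (toℕ x)) (toℕ b) A × blobRank A ≡ 0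
    to {A} (I , _ , _) with Equivalence.to (IsIndexing⇔IndexingAfter₀ {A = (x , b) ∷ A}) I
    ... | _ , _ , _ , after = after , IndexingAfter-blobRank _ _ 1≤b after
    from : ∀ {A} → IndexingAfter (suc (toℕ x)) (toℕ b) A × blobRank A ≡ 0 → PositiveHeadedBy j (x , b) A
    from {A} (after , _) =
      Equivalence.from (IsIndexing⇔IndexingAfter₀ {A = (x , b) ∷ A}) (z≤n , b≤x , 0⊏ (toℕ b) , after) ,
      positive , sym j≡x
      where
      positive : Positive ((x , b) ∷ A)
      positive fzero    = <-≤-trans 1≤b b≤x , 1≤b
      positive (fsuc k) = IndexingAfter-positive _ _ 1≤b after k

  θHeadCount : ∀ m j (x b : Fin n) →
    count (positiveHeadedBy? j (x , b)) (allMatrices n m) ≡ θHead (chains m) j (toℕ x) (toℕ b)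
  θHeadCount m j x b = byCases (j ≟ toℕ x) (toℕ b ≤? toℕ x) (0 <? toℕ b)
    where
    byCases : (j≟x : Dec (j ≡ toℕ x)) (b≤?x : Dec (toℕ b ≤ toℕ x)) (0<?b : Dec (0 < toℕ b)) →
      count (positiveHeadedBy? j (x , b)) (allMatrices n m)
        ≡ [ j≟x ]· [ b≤?x ]· [ 0<?b ]· chains m (suc (toℕ x)) (toℕ b) 0
    byCases (no j≢x)  _         _         = count-none (positiveHeadedBy? j (x , b))
      (λ A p → j≢x (sym (proj₂ (proj₂ p)))) (allMatrices n m)
    byCases (yes _)   (no b≰x)  _         = count-none (positiveHeadedBy? j (x , b))
      (λ A p → b≰x (proj₂ (proj₂ (proj₂ (proj₁ p))) fzero)) (allMatrices n m)
    byCases (yes _)   (yes _)   (no b≯0)  = count-none (positiveHeadedBy? j (x , b))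
      (λ A p → b≯0 (proj₂ (proj₁ (proj₂ p) fzero))) (allMatrices n m)
    byCases (yes j≡x) (yes b≤x) (yes 0<b) =
      trans (positiveHeadedCount m j x b j≡x 0<b b≤x) (indexingCount≡chains m _ _ _)

  countθ≡ : ∀ j m → countθ j n m ≡ ∑[ x < n ] ∑[ b < n ] θHead (chains m) j x b
  countθ≡ j m = count-byHead m (λ A → isIndexing? A ×-dec positive? A ×-dec (c11 A ≟ j)) (θHead (chains m) j)
    (θHeadCount m j)

  chains-vanish : ∀ m lo y r → n < suc m + lo → chains (suc m) lo y r ≡ 0
  chains-vanish zero    lo y r n<1+lo = ∑-≡0 n (λ x x<n → ∑-≡0 n (λ b _ →
    []·-no (lo ≤? x) _ (λ lo≤x → <-irrefl refl (<-≤-trans n<1+lo (≤-trans (s≤s lo≤x) x<n)))))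
  chains-vanish (suc m) lo y r n<2+m+lo = ∑-≡0 n (λ x _ → ∑-≡0 n (λ b _ →
    []·-by (lo ≤? x) (λ lo≤x → []·-≡0 (b ≤? x) (afterHead-≡0 y b (y <? b) r (λ b' r' →
      chains-vanish m (suc x) b' r' (<-≤-trans n<2+m+lo (≤-trans (+-monoʳ-≤ (2 + m) lo≤x)
                                                                 (≤-reflexive (sym (+-suc (suc m) x))))))))))

  chains-blobFree : ∀ m lo y r → 1 ≤ y → chains m lo y (suc r) ≡ 0
  chains-blobFree zero    lo y       r _ = refl
  chains-blobFree (suc m) lo (suc y) r _ = ∑-≡0 n (λ x _ → ∑-≡0 n (λ b _ →
    []·-≡0 (lo ≤? x) ([]·-≡0 (b ≤? x) (afterHead-positive y b (suc y <? b) (suc r) (λ y<b →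
      chains-blobFree m (suc x) b r (≤-trans (s≤s z≤n) y<b))))))

  chainsBelow : (k lo y r : ℕ) → ℕ
  chainsBelow k lo y r = ∑[ m < k ] chains m lo y r

  chainsBelow-suc : ∀ k lo y r →
    chainsBelow (suc k) lo y r ≡ chains 0 lo y r + ∑[ x < n ] ∑[ b < n ] headTerm (chainsBelow k) lo y r x b
  chainsBelow-suc k lo y r = cong (chains 0 lo y r +_) (begin
    ∑[ m < k ] ∑[ x < n ] ∑[ b < n ] headTerm (chains m) lo y r x b
      ≡⟨ ∑-comm k n _ ⟩
    ∑[ x < n ] ∑[ m < k ] ∑[ b < n ] headTerm (chains m) lo y r x b
      ≡⟨ ∑-cong n (λ x _ → ∑-comm k n _) ⟩
    ∑[ x < n ] ∑[ b < n ] ∑[ m < k ] headTerm (chains m) lo y r x b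
      ≡⟨ ∑-cong n (λ x _ → ∑-cong n (λ b _ → ∑-headTerm k chains lo y r x b)) ⟩
    ∑[ x < n ] ∑[ b < n ] headTerm (chainsBelow k) lo y r x b
      ∎)
    where open ≡-Reasoning

  allChains : (lo y r : ℕ) → ℕ
  allChains = chainsBelow (suc n)

  chainsBelow-saturated : ∀ x y r → x < n → chainsBelow n (suc x) y r ≡ allChains (suc x) y r
  chainsBelow-saturated x y r x<n = sym (begin
    chainsBelow (suc n) (suc x) y r               ≡⟨ ∑-last n (λ m → chains m (suc x) y r) ⟩
    chainsBelow n (suc x) y r + chains n (suc x) y r ≡⟨ cong (chainsBelow n (suc x) y r +_) (vanish n x<n ≤-refl) ⟩
    chainsBelow n (suc x) y r + 0                  ≡⟨ +-identityʳ _ ⟩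
    chainsBelow n (suc x) y r                      ∎)
    where
    open ≡-Reasoning
    vanish : ∀ m → x < m → n ≤ m → chains m (suc x) y r ≡ 0
    vanish (suc m) _ n≤1+m = chains-vanish m (suc x) y r (≤-<-trans n≤1+m (m<m+n (suc m) (s≤s z≤n)))

  allChains-rec : ∀ lo y r →
    allChains lo y r ≡ chains 0 lo y r + ∑[ x < n ] ∑[ b < n ] headTerm allChains lo y r x b
  allChains-rec lo y r = trans (chainsBelow-suc n lo y r) (cong (chains 0 lo y r +_)
    (∑-cong n (λ x x<n → ∑-cong n (λ b _ →
      headTerm-cong {chainsBelow n} {allChains} lo y r x b (λ b' r' → chainsBelow-saturated x b' r' x<n)))))

  Ω≡allChains : ∀ r → Ω r n ≡ allChains 0 0 r
  Ω≡allChains r = cong₂ _+_ (degenerate≡chains r)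
    (trans (sum-map-upTo n (countWidth r n ∘ suc)) (∑-cong n (λ m _ → countWidth≡chains (suc m))))
    where
    degenerate≡chains : ∀ r → degenerate r ≡ chains 0 0 0 r
    degenerate≡chains zero    = refl
    degenerate≡chains (suc r) = refl
    countWidth≡chains : ∀ m → countWidth r n m ≡ chains m 0 0 r
    countWidth≡chains m = trans
      (count-≐ _ _ (map₁ (Equivalence.to IsIndexing⇔IndexingAfter₀) ,
                    map₁ (Equivalence.from IsIndexing⇔IndexingAfter₀)) (allMatrices n m))
      (indexingCount≡chains m 0 0 r)

  rank0HeadedAt : ℕ → ℕ → ℕ
  rank0HeadedAt x y = ∑[ b < n ] ([ b ≤? x ]· [ y <? b ]· allChains (suc x) b 0)

  θ≡rank0HeadedAt : ∀ j → j < n → θ j n ≡ rank0HeadedAt j 0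
  θ≡rank0HeadedAt j j<n = begin
    sum (map (countθ j n) (upTo (suc (n ∸ 1))))
      ≡⟨ cong (λ k → sum (map (countθ j n) (upTo k))) (+-∸-assoc 1 (≤-<-trans z≤n j<n)) ⟨
    sum (map (countθ j n) (upTo n))
      ≡⟨ sum-map-upTo n (countθ j n) ⟩
    ∑[ m < n ] countθ j n m
      ≡⟨ ∑-cong n (λ m _ → countθ≡ j m) ⟩
    ∑[ m < n ] ∑[ x < n ] ∑[ b < n ] θHead (chains m) j x b
      ≡⟨ trans (∑-comm n n _) (∑-cong n (λ x _ → ∑-comm n n _)) ⟩
    ∑[ x < n ] ∑[ b < n ] ∑[ m < n ] θHead (chains m) j x b
      ≡⟨ ∑-cong n (λ x _ → ∑-cong n (λ b _ → ∑-θHead x b)) ⟩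
    ∑[ x < n ] ∑[ b < n ] θHead (chainsBelow n) j x b
      ≡⟨ ∑-cong n (λ x _ → ∑-[]· n (j ≟ x) _) ⟩
    ∑[ x < n ] ([ j ≟ x ]· ∑[ b < n ] ([ b ≤? x ]· [ 0 <? b ]· chainsBelow n (suc x) b 0))
      ≡⟨ ∑-delta n j (λ x → ∑[ b < n ] ([ b ≤? x ]· [ 0 <? b ]· chainsBelow n (suc x) b 0)) j<n ⟩
    ∑[ b < n ] ([ b ≤? j ]· [ 0 <? b ]· chainsBelow n (suc j) b 0)
      ≡⟨ ∑-cong n (λ b _ → cong (λ v → [ b ≤? j ]· [ 0 <? b ]· v) (chainsBelow-saturated j b 0 j<n)) ⟩
    rank0HeadedAt j 0
      ∎
    where
    open ≡-Reasoning
    ∑-θHead : ∀ x b → ∑[ m < n ] θHead (chains m) j x b ≡ θHead (chainsBelow n) j x b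
    ∑-θHead x b = begin
      ∑[ m < n ] ([ j ≟ x ]· [ b ≤? x ]· [ 0 <? b ]· chains m (suc x) b 0)
        ≡⟨ ∑-[]· n (j ≟ x) _ ⟩
      [ j ≟ x ]· ∑[ m < n ] ([ b ≤? x ]· [ 0 <? b ]· chains m (suc x) b 0)
        ≡⟨ cong ([ j ≟ x ]·_) (∑-[]· n (b ≤? x) _) ⟩
      [ j ≟ x ]· [ b ≤? x ]· ∑[ m < n ] ([ 0 <? b ]· chains m (suc x) b 0)
        ≡⟨ cong (λ v → [ j ≟ x ]· [ b ≤? x ]· v) (∑-[]· n (0 <? b) _) ⟩
      θHead (chainsBelow n) j x b
        ∎

  allChains-rank0 : ∀ lo y → allChains lo y 0 ≡ 1 + ∑[ x < n ] ([ lo ≤? x ]· rank0HeadedAt x y)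
  allChains-rank0 lo y = trans (allChains-rec lo y 0) (cong suc (∑-cong n (λ x _ → headColumns x)))
    where
    headColumns : ∀ x → ∑[ b < n ] headTerm allChains lo y 0 x b ≡ [ lo ≤? x ]· rank0HeadedAt x y
    headColumns x = trans (∑-[]· n (lo ≤? x) _) (cong ([ lo ≤? x ]·_) (∑-cong n (λ b _ →
      cong ([ b ≤? x ]·_) (afterHead-rank0 (allChains (suc x)) y b (y <? b)))))

  allChains-blobFree : ∀ lo y r → 1 ≤ y → allChains lo y (suc r) ≡ 0
  allChains-blobFree lo y r 1≤y = ∑-≡0 (suc n) (λ m _ → chains-blobFree m lo y r 1≤y)

  allChains-blob : ∀ lo r → allChains lo 0 (suc r) ≡ ∑[ x < n ] ([ lo ≤? x ]· allChains (suc x) 0 r)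
  allChains-blob lo r = trans (allChains-rec lo 0 (suc r)) (∑-cong n (λ x x<n → headColumns x x<n))
    where
    headColumns : ∀ x → x < n → ∑[ b < n ] headTerm allChains lo 0 (suc r) x b ≡ [ lo ≤? x ]· allChains (suc x) 0 r
    headColumns x x<n = ∑-head n _ (≤-<-trans z≤n x<n) (λ t →
      []·-≡0 (lo ≤? x) ([]·-≡0 (suc t ≤? x) (allChains-blobFree (suc x) (suc t) r (s≤s z≤n))))

  allChains-blob-split : ∀ lo r → lo < n →
    allChains lo 0 (suc r) ≡ allChains (suc lo) 0 r + allChains (suc lo) 0 (suc r)
  allChains-blob-split lo r lo<n = begin
    allChains lo 0 (suc r)
      ≡⟨ allChains-blob lo r ⟩
    ∑[ x < n ] ([ lo ≤? x ]· allChains (suc x) 0 r)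
      ≡⟨ ∑-from-split n lo (λ x → allChains (suc x) 0 r) lo<n ⟩
    allChains (suc lo) 0 r + ∑[ x < n ] ([ suc lo ≤? x ]· allChains (suc x) 0 r)
      ≡⟨ cong (allChains (suc lo) 0 r +_) (allChains-blob (suc lo) r) ⟨
    allChains (suc lo) 0 r + allChains (suc lo) 0 (suc r)
      ∎
    where open ≡-Reasoning

  allChains-binomial : ∀ d lo r → lo + d ≡ n →
    allChains lo 0 (suc r) ≡ ∑[ t < d ] ((t C r) * allChains (suc (lo + t)) 0 0)
  allChains-binomial zero lo r lo+0≡n = trans (allChains-blob lo r) (∑-≡0 n (λ x x<n →
    []·-no (lo ≤? x) _ (<⇒≱ (subst (x <_) (trans (sym lo+0≡n) (+-identityʳ lo)) x<n))))
  allChains-binomial (suc d) lo r lo+1+d≡n = trans (allChains-blob-split lo r lo<n) (pascalStep r)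
    where
    1+lo+d≡n : suc lo + d ≡ n
    1+lo+d≡n = trans (sym (+-suc lo d)) lo+1+d≡n
    lo<n : lo < n
    lo<n = ≤-trans (s≤s (m≤m+n lo d)) (≤-reflexive 1+lo+d≡n)
    G : ℕ → ℕ
    G t = allChains (suc (lo + t)) 0 0
    G-suc : ∀ t → allChains (suc (suc lo + t)) 0 0 ≡ G (suc t)
    G-suc t = cong (λ l → allChains (suc l) 0 0) (sym (+-suc lo t))
    pascalStep : ∀ r → allChains (suc lo) 0 r + allChains (suc lo) 0 (suc r) ≡ ∑[ t < suc d ] ((t C r) * G t)
    pascalStep zero = cong₂ _+_
      (trans (cong (λ l → allChains (suc l) 0 0) (sym (+-identityʳ lo))) (sym (*-identityˡ (G 0))))
      (trans (allChains-binomial d (suc lo) 0 1+lo+d≡n) (∑-cong d (λ t _ → cong ((suc t C 0) *_) (G-suc t))))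
    pascalStep (suc r) = begin
      allChains (suc lo) 0 (suc r) + allChains (suc lo) 0 (2 + r)
        ≡⟨ cong₂ _+_ (allChains-binomial d (suc lo) r 1+lo+d≡n) (allChains-binomial d (suc lo) (suc r) 1+lo+d≡n) ⟩
      ∑[ t < d ] ((t C r) * G′ t) + ∑[ t < d ] ((t C suc r) * G′ t)
        ≡⟨ ∑-distrib-+ d _ _ ⟨
      ∑[ t < d ] ((t C r) * G′ t + (t C suc r) * G′ t)
        ≡⟨ ∑-cong d (λ t _ → trans (cong (_* G′ t) (pascal t r)) (*-distribʳ-+ (G′ t) (t C r) (t C suc r))) ⟨
      ∑[ t < d ] ((suc t C suc r) * G′ t)
        ≡⟨ ∑-cong d (λ t _ → cong ((suc t C suc r) *_) (G-suc t)) ⟩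
      ∑[ t < suc d ] ((t C suc r) * G t)
        ∎
      where
      open ≡-Reasoning
      G′ : ℕ → ℕ
      G′ t = allChains (suc (suc lo + t)) 0 0

  allChains-rank0-split : ∀ lo y → lo < n → allChains lo y 0 ≡ rank0HeadedAt lo y + allChains (suc lo) y 0
  allChains-rank0-split lo y lo<n = begin
    allChains lo y 0
      ≡⟨ allChains-rank0 lo y ⟩
    1 + ∑[ x < n ] ([ lo ≤? x ]· rank0HeadedAt x y)
      ≡⟨ cong suc (∑-from-split n lo (λ x → rank0HeadedAt x y) lo<n) ⟩
    1 + (rank0HeadedAt lo y + ∑[ x < n ] ([ suc lo ≤? x ]· rank0HeadedAt x y))
      ≡⟨ +-suc (rank0HeadedAt lo y) _ ⟨
    rank0HeadedAt lo y + (1 + ∑[ x < n ] ([ suc lo ≤? x ]· rank0HeadedAt x y))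
      ≡⟨ cong (rank0HeadedAt lo y +_) (allChains-rank0 (suc lo) y) ⟨
    rank0HeadedAt lo y + allChains (suc lo) y 0
      ∎
    where open ≡-Reasoning

  rank0HeadedAt-peel : ∀ x y → y < x → x < n →
    rank0HeadedAt x y ≡ allChains (suc x) (suc y) 0 + rank0HeadedAt x (suc y)
  rank0HeadedAt-peel x y y<x x<n = begin
    ∑[ b < n ] ([ b ≤? x ]· [ y <? b ]· V b)
      ≡⟨ ∑-cong n (λ b _ → trans (cong ([ b ≤? x ]·_) ([<]-split y b (V b))) ([]·-distrib-+ (b ≤? x) _ _)) ⟩
    ∑[ b < n ] ([ b ≤? x ]· [ suc y ≟ b ]· V b + [ b ≤? x ]· [ suc y <? b ]· V b)
      ≡⟨ ∑-distrib-+ n _ _ ⟩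
    ∑[ b < n ] ([ b ≤? x ]· [ suc y ≟ b ]· V b) + rank0HeadedAt x (suc y)
      ≡⟨ cong (_+ rank0HeadedAt x (suc y)) (∑-cong n (λ b _ → []·-comm (b ≤? x) (suc y ≟ b) (V b))) ⟩
    ∑[ b < n ] ([ suc y ≟ b ]· [ b ≤? x ]· V b) + rank0HeadedAt x (suc y)
      ≡⟨ cong (_+ rank0HeadedAt x (suc y)) (∑-delta n (suc y) (λ b → [ b ≤? x ]· V b) (≤-<-trans y<x x<n)) ⟩
    [ suc y ≤? x ]· V (suc y) + rank0HeadedAt x (suc y)
      ≡⟨ cong (_+ rank0HeadedAt x (suc y)) ([]·-yes (suc y ≤? x) (V (suc y)) y<x) ⟩
    V (suc y) + rank0HeadedAt x (suc y)
      ∎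
    where
    open ≡-Reasoning
    V : ℕ → ℕ
    V b = allChains (suc x) b 0

  rank0HeadedAt-diagonal : ∀ x → rank0HeadedAt x x ≡ 0
  rank0HeadedAt-diagonal x = ∑-≡0 n (λ b _ → []·-by (b ≤? x) (λ b≤x → []·-no (x <? b) _ (≤⇒≯ b≤x)))

  allChains-rank0-θ : ∀ i → allChains (suc i) 0 0 ≡ 1 + sumFromTo (suc i) (n ∸ 1) (λ j → θ j n)
  allChains-rank0-θ i = begin
    allChains (suc i) 0 0                        ≡⟨ allChains-rank0 (suc i) 0 ⟩
    1 + ∑[ x < n ] ([ suc i ≤? x ]· rank0HeadedAt x 0)
      ≡⟨ cong suc (∑-cong n (λ x x<n → cong ([ suc i ≤? x ]·_) (θ≡rank0HeadedAt x x<n))) ⟨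
    1 + ∑[ x < n ] ([ suc i ≤? x ]· θ x n)        ≡⟨ cong suc (∑-from n (suc i) (λ j → θ j n)) ⟩
    1 + ∑[ t < n ∸ suc i ] θ (suc i + t) n
      ≡⟨ cong (λ k → 1 + ∑[ t < k ] θ (suc i + t) n) (∸-+-assoc n 1 i) ⟨
    1 + ∑[ t < n ∸ 1 ∸ i ] θ (suc i + t) n
      ≡⟨ cong suc (sumFromTo≡∑ (suc i) (n ∸ 1) (λ j → θ j n)) ⟨
    1 + sumFromTo (suc i) (n ∸ 1) (λ j → θ j n)   ∎
    where open ≡-Reasoning

  Ω-positiveRank : ∀ r → 1 ≤ n →
    Ω (suc r) n ≡ sumFromTo r (n ∸ 1) (λ i → (i C r) * (1 + sumFromTo (suc i) (n ∸ 1) (λ j → θ j n)))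
  Ω-positiveRank r 1≤n = begin
    Ω (suc r) n                                   ≡⟨ Ω≡allChains (suc r) ⟩
    allChains 0 0 (suc r)                         ≡⟨ allChains-binomial n 0 r refl ⟩
    ∑[ t < n ] ((t C r) * allChains (suc t) 0 0)  ≡⟨ ∑-cong n (λ t _ → term t (r ≤? t)) ⟩
    ∑[ t < n ] ([ r ≤? t ]· g t)                  ≡⟨ ∑-from n r g ⟩
    ∑[ t < n ∸ r ] g (r + t)                      ≡⟨ cong (λ k → ∑[ t < k ∸ r ] g (r + t)) n≡1+[n∸1] ⟩
    ∑[ t < suc (n ∸ 1) ∸ r ] g (r + t)            ≡⟨ sumFromTo≡∑ r (n ∸ 1) g ⟨
    sumFromTo r (n ∸ 1) g                         ∎
    where
    open ≡-Reasoning
    n≡1+[n∸1] : n ≡ suc (n ∸ 1)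
    n≡1+[n∸1] = +-∸-assoc 1 1≤n
    g : ℕ → ℕ
    g i = (i C r) * (1 + sumFromTo (suc i) (n ∸ 1) (λ j → θ j n))
    term : ∀ t (r≤?t : Dec (r ≤ t)) → (t C r) * allChains (suc t) 0 0 ≡ [ r≤?t ]· g t
    term t (yes _)   = cong ((t C r) *_) (allChains-rank0-θ t)
    term t (no r≰t)  = cong (_* allChains (suc t) 0 0) (k>n⇒nCk≡0 (≰⇒> r≰t))

  Ω-maximalRank : 1 ≤ n → Ω n n ≡ 1
  Ω-maximalRank 1≤n = begin
    Ω n n                                                ≡⟨ cong (λ r → Ω r n) (+-∸-assoc 1 1≤n) ⟩
    Ω (suc (n ∸ 1)) n                                    ≡⟨ Ω-positiveRank (n ∸ 1) 1≤n ⟩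
    sumFromTo (n ∸ 1) (n ∸ 1) g                          ≡⟨ sumFromTo-single (n ∸ 1) g ⟩
    ((n ∸ 1) C (n ∸ 1)) * (1 + sumFromTo (suc (n ∸ 1)) (n ∸ 1) (λ j → θ j n))
      ≡⟨ cong₂ (λ c s → c * (1 + s)) (nCn≡1 (n ∸ 1)) (sumFromTo-empty (n ∸ 1) (λ j → θ j n)) ⟩
    1                                                    ∎
    where
    open ≡-Reasoning
    g : ℕ → ℕ
    g i = (i C (n ∸ 1)) * (1 + sumFromTo (suc i) (n ∸ 1) (λ j → θ j n))

  rank0HeadedAt-ballot : ∀ a lo → lo < n →
    (∀ y h → suc (y + h) ≡ suc lo → allChains (suc lo) y 0 ≡ ballot′ a h) →
    ∀ h y → suc (y + h) ≡ lo → rank0HeadedAt lo y ≡ ∑[ h′ < suc h ] ballot′ a h′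
  rank0HeadedAt-ballot a lo lo<n tails zero y 1+y+0≡lo = begin
    rank0HeadedAt lo y                                       ≡⟨ rank0HeadedAt-peel lo y (≤-reflexive 1+y≡lo) lo<n ⟩
    allChains (suc lo) (suc y) 0 + rank0HeadedAt lo (suc y)  ≡⟨ cong₂ _+_ (tails (suc y) 0 (cong suc 1+y+0≡lo))
                                                                          (trans (cong (rank0HeadedAt lo) 1+y≡lo)
                                                                                 (rank0HeadedAt-diagonal lo)) ⟩
    ballot′ a 0 + 0                                          ∎
    where
    open ≡-Reasoning
    1+y≡lo = trans (cong suc (sym (+-identityʳ y))) 1+y+0≡lo
  rank0HeadedAt-ballot a lo lo<n tails (suc h) y 1+y+1+h≡lo = begin
    rank0HeadedAt lo y                                       ≡⟨ rank0HeadedAt-peel lo y y<lo lo<n ⟩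
    allChains (suc lo) (suc y) 0 + rank0HeadedAt lo (suc y)  ≡⟨ cong₂ _+_ (tails (suc y) (suc h) (cong suc 1+y+1+h≡lo))
                                                                          (rank0HeadedAt-ballot a lo lo<n tails h (suc y)
                                                                            (trans (cong suc (sym (+-suc y h))) 1+y+1+h≡lo)) ⟩
    ballot′ a (suc h) + ∑[ h′ < suc h ] ballot′ a h′          ≡⟨ +-comm (ballot′ a (suc h)) _ ⟩
    ∑[ h′ < suc h ] ballot′ a h′ + ballot′ a (suc h)          ≡⟨ ∑-last (suc h) (ballot′ a) ⟨
    ∑[ h′ < 2 + h ] ballot′ a h′                             ∎
    where
    open ≡-Reasoning
    y<lo = ≤-trans (s≤s (m≤m+n y (suc h))) (≤-reflexive 1+y+1+h≡lo)

  allChains-ballot : ∀ a lo y h → lo + a ≡ n → suc (y + h) ≡ lo → allChains lo y 0 ≡ ballot′ a h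
  allChains-ballot zero lo y h lo+0≡n _ = begin
    allChains lo y 0                                ≡⟨ allChains-rank0 lo y ⟩
    1 + ∑[ x < n ] ([ lo ≤? x ]· rank0HeadedAt x y) ≡⟨ cong suc (∑-≡0 n (λ x x<n → []·-no (lo ≤? x) _ (<⇒≱ (x<lo x<n)))) ⟩
    1                                               ≡⟨ ballot-diagonal (suc h) ⟨
    ballot′ 0 h                                     ∎
    where
    open ≡-Reasoning
    x<lo : ∀ {x} → x < n → x < lo
    x<lo = subst (_ <_) (trans (sym lo+0≡n) (+-identityʳ lo))
  allChains-ballot (suc a) lo y h lo+1+a≡n 1+y+h≡lo = begin
    allChains lo y 0                                 ≡⟨ allChains-rank0-split lo y lo<n ⟩
    rank0HeadedAt lo y + allChains (suc lo) y 0      ≡⟨ cong₂ _+_ (rank0HeadedAt-ballot a lo lo<n tails h y 1+y+h≡lo)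
                                                                  (tails y (suc h) (cong suc (trans (+-suc y h) 1+y+h≡lo))) ⟩
    ∑[ h′ < suc h ] ballot′ a h′ + ballot′ a (suc h)  ≡⟨ +-comm _ (ballot′ a (suc h)) ⟩
    ballot′ a (suc h) + ∑[ h′ < suc h ] ballot′ a h′  ≡⟨ ballot′-rec a h ⟨
    ballot′ (suc a) h                                ∎
    where
    open ≡-Reasoning
    1+lo+a≡n : suc lo + a ≡ n
    1+lo+a≡n = trans (sym (+-suc lo a)) lo+1+a≡n
    lo<n : lo < n
    lo<n = ≤-trans (s≤s (m≤m+n lo a)) (≤-reflexive 1+lo+a≡n)
    tails : ∀ y h → suc (y + h) ≡ suc lo → allChains (suc lo) y 0 ≡ ballot′ a h
    tails y h = allChains-ballot a (suc lo) y h 1+lo+a≡n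

  Ω-rank0 : 1 ≤ n → Ω 0 n ≡ Catalan n
  Ω-rank0 1≤n = begin
    Ω 0 n                                   ≡⟨ Ω≡allChains 0 ⟩
    allChains 0 0 0                         ≡⟨ allChains-rank0-split 0 0 1≤n ⟩
    rank0HeadedAt 0 0 + allChains 1 0 0
      ≡⟨ cong₂ _+_ (rank0HeadedAt-diagonal 0) (allChains-ballot q 1 0 0 (sym n≡1+q) refl) ⟩
    ballot (suc (q + q + 0)) 1              ≡⟨ cong (λ L → ballot L 1) (arith q) ⟩
    ballot (suc q + suc q) 0                ≡⟨ Catalan≡ballot q ⟨
    Catalan (suc q)                         ≡⟨ cong Catalan n≡1+q ⟨
    Catalan n                               ∎
    where
    open ≡-Reasoning
    q = n ∸ 1
    n≡1+q : n ≡ suc q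
    n≡1+q = +-∸-assoc 1 1≤n
    arith : ∀ q → suc (q + q + 0) ≡ q + suc q
    arith = solve-∀

lemma5p5 : ∀ (n : ℕ) → 1 ≤ n →
    (Ω 0 n ≡ Catalan n)
    × (Ω n n ≡ 1)
    × (∀ (r : ℕ) → 1 ≤ r → r ≤ n ∸ 1 →
         Ω r n ≡ sumFromTo (r ∸ 1) (n ∸ 1)
                   (λ i → (i C (r ∸ 1)) * (1 + sumFromTo (suc i) (n ∸ 1) (λ j → θ j n))))
lemma5p5 n 1≤n = Ω-rank0 n 1≤n , Ω-maximalRank n 1≤n , λ { zero () ; (suc r) _ _ → Ω-positiveRank n r 1≤n }
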